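{- (1) For $n,m\in\mathbf N$ with $1\le m\le n$: $\left\langle n \atop m\right\rangle=\sum_{j=1}^{n-m}j\left\langle n-j-1 \atop m-1\right\rangle^{(j+1,1)}$. (2) For $n,m,\nu\in\mathbf N_0$ with $0\le m\le n$ and $1\le\nu\le n-1$: $\left\langle n \atop m\right\rangle=\sum_{k=0}^{\nu}\left\langle \nu \atop k\right\rangle\left\langle n-\nu \atop m-k\right\rangle^{(\nu,k)}$.
   Context: Euler numbers: $\left\langle 0 \atop 0\right\rangle=1$, $\left\langle n \atop k\right\rangle=(n-k)\left\langle n-1 \atop k-1\right\rangle+(k+1)\left\langle n-1 \atop k\right\rangle$, and $0$ if $k<0$ or $k>n$. Associated Euler numbers of rank $(\nu,\mu)$, $0\le\mu\le\nu$: for $a\ge1$, $0\le b\le a$, $\left\langle a \atop b\right\rangle^{(\nu,\mu)}=\sum w(\omega)$ over $\omega=(\varepsilon_1,\dots,\varepsilon_a)\in\{0,1\}^a$ with exactly $b$ zeros, where $w(\omega)=\prod_{m=1}^ag_m$ with $k_m=\#\{l<m:\varepsilon_l=0\}$, $g_m=\alpha'_{m-k_m}$ if $\varepsilon_m=0$ and $g_m=\beta'_{k_m}$ if $\varepsilon_m=1$, for the sequences $\alpha'_i=\alpha_{\nu-\mu+i}=\nu-\mu+i-1$ ($i\ge1$) and $\beta'_i=\beta_{\mu+i}=\mu+i+1$ ($i\ge0$); $\left\langle 0 \atop 0\right\rangle^{(\nu,\mu)}=1$ and $\left\langle a \atop b\right\rangle^{(\nu,\mu)}=0$ if $b<0$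 or $b>a$. -}

module Defs where

open import Data.Nat using (ℕ; zero; suc; _+_; _*_; _∸_; _≤ᵇ_)
open import Data.Bool using (Bool; true; false; if_then_else_)
open import Data.List using (List; []; _∷_; map; filter; _++_; upTo)
open import Data.Nat.ListAction using (sum)
open import Data.Nat using (_≟_)

-- Eulerian numbers ⟨ n , k ⟩ (0 outside 0 ≤ k ≤ n)
euler : ℕ → ℕ → ℕ
euler zero zero = 1
euler zero (suc k) = 0
euler (suc n) zero = 1 * euler n zero  -- (n+1)*⟨n,-1⟩ = 0, plus (0+1)*⟨n,0⟩
euler (suc n) (suc k) = ((suc n) ∸ (suc k)) * euler n k + (suc (suc k)) * euler n (suc k)

-- all 0/1-words of length a, true = ε = 1, false = ε = 0
words : ℕ → List (List Bool)
words zero = [] ∷ []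
words (suc a) = map (false ∷_) (words a) ++ map (true ∷_) (words a)

zeros : List Bool → ℕ
zeros [] = 0
zeros (false ∷ w) = suc (zeros w)
zeros (true ∷ w) = zeros w

α' : ℕ → ℕ → ℕ → ℕ
α' ν μ i = (ν ∸ μ) + i ∸ 1

β' : ℕ → ℕ → ℕ → ℕ
β' ν μ i = μ + i + 1

-- weight of a word; m = current (1-based) position, k = #zeros before position m
weightFrom : ℕ → ℕ → ℕ → ℕ → List Bool → ℕ
weightFrom ν μ m k [] = 1
weightFrom ν μ m k (false ∷ w) = α' ν μ (m ∸ k) * weightFrom ν μ (suc m) (suc k) w
weightFrom ν μ m k (true ∷ w) = β' ν μ k * weightFrom ν μ (suc m) k w

weight : ℕ → ℕ → List Bool → ℕ
weight ν μ w = weightFrom ν μ 1 0 w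


-- associated Euler number ⟨ a , b ⟩^(ν,μ) for b ≥ 0 (b > a gives 0; a = 0 , b = 0 gives 1)
assocEuler : ℕ → ℕ → ℕ → ℕ → ℕ
assocEuler ν μ a b = sum (map (weight ν μ) (filter (λ w → zeros w Data.Nat.≟ b) (words a)))

-- ⟨ a , m - k ⟩^(ν,μ) with the convention that it is 0 when m - k < 0
assocEulerSub : ℕ → ℕ → ℕ → ℕ → ℕ → ℕ
assocEulerSub ν μ a m k = if k ≤ᵇ m then assocEuler ν μ a (m ∸ k) else 0

sumFromTo : ℕ → ℕ → (ℕ → ℕ) → ℕ
sumFromTo lo hi f = sum (map (λ i → f (lo + i)) (upTo (suc hi ∸ lo)))

-- Both sides are weighted counts of 0/1-words in which a zero weighs x plus the
-- number of ones before it and a one weighs y plus the number of zeros before it.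
-- Splitting off the first letter gives the defining recursion of these numbers,
-- splitting off the last gives Euler's recurrence with coefficients x + a ∸ b and
-- y + b + 1; so ⟨n, m⟩ is the case x = 0, y = 1, and (1) splits a word at its first
-- zero. For (2), shifting the column index by k turns the numbers with offsets
-- (ν ∸ k, k + 1) into a solution of Euler's recurrence for the rows ν + a; the
-- combination with coefficients ⟨ν, k⟩ is again a solution and agrees with ⟨ν, m⟩
-- at a = 0, where only k = m survives, so it agrees everywhere.

module Submission where

open import Defs
open import Data.Bool using (Bool; true; false; if_then_else_)
open import Data.List using (List; []; _∷_; map; filter; _++_; applyUpTo)
open import Data.List.Properties using (map-++; map-∘; map-cong; map-upTo)
open import Data.Nat using (_≟_; ℕ; zero; suc; _+_; _*_; _∸_; _≤_; _<_; _≤ᵇ_; _≡ᵇ_; z≤n; s≤s)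
open import Data.Nat.ListAction using (sum)
open import Data.Nat.ListAction.Properties using (sum-++)
open import Data.Nat.Properties
open import Data.Nat.Tactic.RingSolver using (solve-∀)
open import Data.Product using (_×_; _,_)
open import Function using (_∘_)
open import Relation.Binary.PropositionalEquality
open import Relation.Nullary using (does)
open import Relation.Unary using (Pred; Decidable)

sum-map-filter : ∀ {a p} {A : Set a} {P : Pred A p} (P? : Decidable P) (f : A → ℕ) xs →
                 sum (map f (filter P? xs)) ≡ sum (map (λ x → if does (P? x) then f x else 0) xs)
sum-map-filter P? f []       = refl
sum-map-filter P? f (x ∷ xs) with does (P? x)
... | true  = cong (f x +_) (sum-map-filter P? f xs)
... | false = sum-map-filter P? f xs

sum-map-*ˡ : ∀ {a} {A : Set a} c (f : A → ℕ) xs → sum (map (λ x → c * f x) xs) ≡ c * sum (map f xs)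
sum-map-*ˡ c f []       = sym (*-zeroʳ c)
sum-map-*ˡ c f (x ∷ xs) = trans (cong (c * f x +_) (sum-map-*ˡ c f xs)) (sym (*-distribˡ-+ c (f x) _))

if-*ˡ : ∀ c (t : Bool) n → (if t then c * n else 0) ≡ c * (if t then n else 0)
if-*ˡ c true  n = refl
if-*ˡ c false n = sym (*-zeroʳ c)

sum-map-const0 : ∀ {a} {A : Set a} (xs : List A) → sum (map (λ _ → 0) xs) ≡ 0
sum-map-const0 []       = refl
sum-map-const0 (x ∷ xs) = sum-map-const0 xs

sum-map-factor : ∀ {a} {A : Set a} c (f g : A → ℕ) → (∀ x → f x ≡ c * g x) →
                 ∀ xs → sum (map f xs) ≡ c * sum (map g xs)
sum-map-factor c f g f≡ xs = trans (cong sum (map-cong f≡ xs)) (sum-map-*ˡ c g xs)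

sumBelow : ℕ → (ℕ → ℕ) → ℕ
sumBelow n f = sum (applyUpTo f n)

sumBelow-cong : ∀ n {f g : ℕ → ℕ} → (∀ k → k < n → f k ≡ g k) → sumBelow n f ≡ sumBelow n g
sumBelow-cong zero    f≡g = refl
sumBelow-cong (suc n) f≡g = cong₂ _+_ (f≡g 0 (s≤s z≤n)) (sumBelow-cong n (λ k k<n → f≡g (suc k) (s≤s k<n)))

sumBelow-zero : ∀ n {f : ℕ → ℕ} → (∀ k → f k ≡ 0) → sumBelow n f ≡ 0
sumBelow-zero zero    f≡0 = refl
sumBelow-zero (suc n) f≡0 = cong₂ _+_ (f≡0 0) (sumBelow-zero n (f≡0 ∘ suc))

sumFromTo≡sumBelow : ∀ lo hi f → sumFromTo lo hi f ≡ sumBelow (suc hi ∸ lo) (λ i → f (lo + i))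
sumFromTo≡sumBelow lo hi f = cong sum (map-upTo (λ i → f (lo + i)) (suc hi ∸ lo))

shift : (ℕ → ℕ → ℕ) → ℕ → ℕ → ℕ
shift F a zero    = 0
shift F a (suc b) = F a b

shiftBy : ℕ → (ℕ → ℕ → ℕ) → ℕ → ℕ → ℕ
shiftBy zero    F = F
shiftBy (suc k) F = shift (shiftBy k F)

shiftBy≡if : ∀ k F a m → shiftBy k F a m ≡ (if k ≤ᵇ m then F a (m ∸ k) else 0)
shiftBy≡if zero          F a m       = refl
shiftBy≡if (suc k)       F a zero    = refl
shiftBy≡if (suc zero)    F a (suc m) = refl
shiftBy≡if (suc (suc k)) F a (suc m) = shiftBy≡if (suc k) F a m

sumBelow-sift : ∀ n (f : ℕ → ℕ) (F : ℕ → ℕ → ℕ → ℕ) m →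
                (∀ k → F k 0 0 ≡ 1) → (∀ k b → F k 0 (suc b) ≡ 0) → (n ≤ m → f m ≡ 0) →
                sumBelow n (λ k → f k * shiftBy k (F k) 0 m) ≡ f m
sumBelow-sift zero    f F m       F₀₀ F₀ₛ fm≡0 = sym (fm≡0 z≤n)
sumBelow-sift (suc n) f F zero    F₀₀ F₀ₛ fm≡0 =
  trans (cong₂ _+_ (trans (cong (f 0 *_) (F₀₀ 0)) (*-identityʳ (f 0)))
                   (sumBelow-zero n (λ k → *-zeroʳ (f (suc k)))))
        (+-identityʳ (f 0))
sumBelow-sift (suc n) f F (suc m) F₀₀ F₀ₛ fm≡0 =
  cong₂ _+_ (trans (cong (f 0 *_) (F₀ₛ 0 m)) (*-zeroʳ (f 0)))
            (sumBelow-sift n (f ∘ suc) (F ∘ suc) m (F₀₀ ∘ suc) (F₀ₛ ∘ suc) (fm≡0 ∘ s≤s))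

-- The weighted count of the words with a letters, b of them zeros, split by the first letter.
eulerFrom : ℕ → ℕ → ℕ → ℕ → ℕ
eulerFrom x y zero    zero    = 1
eulerFrom x y zero    (suc b) = 0
eulerFrom x y (suc a) zero    = y * eulerFrom (suc x) y a zero
eulerFrom x y (suc a) (suc b) = x * eulerFrom x (suc y) a b + y * eulerFrom (suc x) y a (suc b)

eulerFrom-noZeros : ∀ x x′ y a → eulerFrom x y a 0 ≡ eulerFrom x′ y a 0
eulerFrom-noZeros x x′ y zero    = refl
eulerFrom-noZeros x x′ y (suc a) = cong (y *_) (eulerFrom-noZeros (suc x) (suc x′) y a)

a<b⇒eulerFrom≡0 : ∀ x y {a b} → a < b → eulerFrom x y a b ≡ 0
a<b⇒eulerFrom≡0 x y {zero}  {suc b} _         = refl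
a<b⇒eulerFrom≡0 x y {suc a} {suc b} (s≤s a<b)
  rewrite a<b⇒eulerFrom≡0 x (suc y) a<b | a<b⇒eulerFrom≡0 (suc x) y (m<n⇒m<1+n a<b)
  = cong₂ _+_ (*-zeroʳ x) (*-zeroʳ y)

eulerFrom-lastLetter : ∀ x y a b → eulerFrom x y (suc a) (suc b) ≡
                       (x + a ∸ b) * eulerFrom x y a b + (y + suc b) * eulerFrom x y a (suc b)
eulerFrom-lastLetter x y zero zero = ring x y
  where
  ring : ∀ x y → x * 1 + y * 0 ≡ (x + 0) * 1 + (y + 1) * 0
  ring = solve-∀
eulerFrom-lastLetter x y zero (suc b) =
  trans (cong₂ _+_ (*-zeroʳ x) (*-zeroʳ y)) (sym (cong₂ _+_ (*-zeroʳ (x + 0 ∸ suc b)) (*-zeroʳ (y + suc (suc b)))))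
eulerFrom-lastLetter x y (suc a) zero = begin
  x * (suc y * eulerFrom (suc x) (suc y) a 0) + y * eulerFrom (suc x) y (suc a) 1
    ≡⟨ cong₂ (λ u v → x * (suc y * u) + y * v) (eulerFrom-noZeros (suc x) x (suc y) a)
                                               (eulerFrom-lastLetter (suc x) y a 0) ⟩
  x * (suc y * S) + y * ((suc x + a) * P + (y + 1) * E) ≡⟨ ring x y a S P E ⟩
  (x + suc a) * (y * P) + (y + 1) * (x * S + y * E)     ∎
  where
  open ≡-Reasoning
  S P E : ℕ
  S = eulerFrom x (suc y) a 0
  P = eulerFrom (suc x) y a 0
  E = eulerFrom (suc x) y a 1
  ring : ∀ x y a S P E → x * (suc y * S) + y * ((suc x + a) * P + (y + 1) * E)
                         ≡ (x + suc a) * (y * P) + (y + 1) * (x * S + y * E)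
  ring = solve-∀
eulerFrom-lastLetter x y (suc a) (suc b) = begin
  x * eulerFrom x (suc y) (suc a) (suc b) + y * eulerFrom (suc x) y (suc a) (suc (suc b))
    ≡⟨ cong₂ (λ u v → x * u + y * v) (eulerFrom-lastLetter x (suc y) a b)
                                     (eulerFrom-lastLetter (suc x) y a (suc b)) ⟩
  x * (c * A₁ + (suc y + suc b) * A₂) + y * (c * B₁ + (y + suc (suc b)) * B₂) ≡⟨ ring x y b c A₁ A₂ B₁ B₂ ⟩
  c * (x * A₁ + y * B₁) + (y + suc (suc b)) * (x * A₂ + y * B₂)
    ≡⟨ cong (λ n → (n ∸ suc b) * (x * A₁ + y * B₁) + (y + suc (suc b)) * (x * A₂ + y * B₂)) (sym (+-suc x a)) ⟩
  (x + suc a ∸ suc b) * (x * A₁ + y * B₁) + (y + suc (suc b)) * (x * A₂ + y * B₂) ∎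
  where
  open ≡-Reasoning
  c A₁ A₂ B₁ B₂ : ℕ
  c = x + a ∸ b
  A₁ = eulerFrom x (suc y) a b
  A₂ = eulerFrom x (suc y) a (suc b)
  B₁ = eulerFrom (suc x) y a (suc b)
  B₂ = eulerFrom (suc x) y a (suc (suc b))
  ring : ∀ x y b c A₁ A₂ B₁ B₂ → x * (c * A₁ + (suc y + suc b) * A₂) + y * (c * B₁ + (y + suc (suc b)) * B₂)
                                 ≡ c * (x * A₁ + y * B₁) + (y + suc (suc b)) * (x * A₂ + y * B₂)
  ring = solve-∀

eulerFrom-firstZero : ∀ x p q → eulerFrom x 1 (suc p + q) (suc p) ≡
                      sumBelow (suc q) (λ i → (x + i) * eulerFrom (x + i) 2 (p + (q ∸ i)) p)
eulerFrom-firstZero x p zero =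
  cong₂ _+_ (cong (λ z → z * eulerFrom z 2 (p + 0) p) (sym (+-identityʳ x)))
            (trans (*-identityˡ _) (a<b⇒eulerFrom≡0 (suc x) 1 (s≤s (≤-reflexive (+-identityʳ p)))))
eulerFrom-firstZero x p (suc q) =
  cong₂ _+_ (cong (λ z → z * eulerFrom z 2 (p + suc q) p) (sym (+-identityʳ x))) (begin
  1 * eulerFrom (suc x) 1 (p + suc q) (suc p)
    ≡⟨ trans (*-identityˡ _) (cong (λ n → eulerFrom (suc x) 1 n (suc p)) (+-suc p q)) ⟩
  eulerFrom (suc x) 1 (suc p + q) (suc p)
    ≡⟨ eulerFrom-firstZero (suc x) p q ⟩
  sumBelow (suc q) (λ i → (suc x + i) * eulerFrom (suc x + i) 2 (p + (q ∸ i)) p)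
    ≡⟨ sumBelow-cong (suc q) (λ i _ → cong (λ z → z * eulerFrom z 2 (p + (q ∸ i)) p) (sym (+-suc x i))) ⟩
  sumBelow (suc q) (λ i → (x + suc i) * eulerFrom (x + suc i) 2 (p + (q ∸ i)) p) ∎)
  where open ≡-Reasoning

wordWeight : ℕ → ℕ → List Bool → ℕ
wordWeight x y []          = 1
wordWeight x y (false ∷ w) = x * wordWeight x (suc y) w
wordWeight x y (true ∷ w)  = y * wordWeight (suc x) y w

suc[k+j]∸k≡suc[j] : ∀ k j → suc (k + j) ∸ k ≡ suc j
suc[k+j]∸k≡suc[j] k j = trans (cong (_∸ k) (sym (+-suc k j))) (m+n∸m≡n k (suc j))

-- j counts the ones and k the zeros read so far.
weightFrom≡wordWeight : ∀ ν μ k j w {x y} → x ≡ (ν ∸ μ) + j → y ≡ μ + k + 1 →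
                        weightFrom ν μ (suc (k + j)) k w ≡ wordWeight x y w
weightFrom≡wordWeight ν μ k j []          x≡ y≡ = refl
weightFrom≡wordWeight ν μ k j (false ∷ w) {x} x≡ y≡ = cong₂ _*_ α'≡x
  (weightFrom≡wordWeight ν μ (suc k) j w x≡ (trans (cong suc y≡) (sym (cong (_+ 1) (+-suc μ k)))))
  where
  α'≡x : α' ν μ (suc (k + j) ∸ k) ≡ x
  α'≡x = begin
    (ν ∸ μ) + (suc (k + j) ∸ k) ∸ 1 ≡⟨ cong (λ i → (ν ∸ μ) + i ∸ 1) (suc[k+j]∸k≡suc[j] k j) ⟩
    (ν ∸ μ) + suc j ∸ 1             ≡⟨ cong (_∸ 1) (+-suc (ν ∸ μ) j) ⟩
    (ν ∸ μ) + j                     ≡⟨ sym x≡ ⟩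
    x                               ∎
    where open ≡-Reasoning
weightFrom≡wordWeight ν μ k j (true ∷ w) x≡ y≡ = cong₂ _*_ (sym y≡) (begin
  weightFrom ν μ (suc (suc (k + j))) k w ≡⟨ cong (λ m → weightFrom ν μ (suc m) k w) (sym (+-suc k j)) ⟩
  weightFrom ν μ (suc (k + suc j)) k w  ≡⟨ weightFrom≡wordWeight ν μ k (suc j) w
                                             (trans (cong suc x≡) (sym (+-suc (ν ∸ μ) j))) y≡ ⟩
  wordWeight _ _ w                       ∎)
  where open ≡-Reasoning

weight≡wordWeight : ∀ ν μ w → weight ν μ w ≡ wordWeight (ν ∸ μ) (suc μ) w
weight≡wordWeight ν μ w = weightFrom≡wordWeight ν μ 0 0 w
  (sym (+-identityʳ (ν ∸ μ))) (trans (cong suc (sym (+-identityʳ μ))) (+-comm 1 (μ + 0)))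

sum-map-words-suc : ∀ (f : List Bool → ℕ) a → sum (map f (words (suc a))) ≡
                    sum (map (f ∘ (false ∷_)) (words a)) + sum (map (f ∘ (true ∷_)) (words a))
sum-map-words-suc f a = begin
  sum (map f (map (false ∷_) W ++ map (true ∷_) W))          ≡⟨ cong sum (map-++ f (map (false ∷_) W) _) ⟩
  sum (map f (map (false ∷_) W) ++ map f (map (true ∷_) W))  ≡⟨ sum-++ (map f (map (false ∷_) W)) _ ⟩
  sum (map f (map (false ∷_) W)) + sum (map f (map (true ∷_) W))
    ≡⟨ sym (cong₂ _+_ (cong sum (map-∘ W)) (cong sum (map-∘ W))) ⟩
  sum (map (f ∘ (false ∷_)) W) + sum (map (f ∘ (true ∷_)) W) ∎
  where
  open ≡-Reasoning
  W : List (List Bool)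
  W = words a

countedWeight : ℕ → ℕ → ℕ → List Bool → ℕ
countedWeight x y b w = if zeros w ≡ᵇ b then wordWeight x y w else 0

sum-countedWeight≡eulerFrom : ∀ x y a b → sum (map (countedWeight x y b) (words a)) ≡ eulerFrom x y a b
sum-countedWeight≡eulerFrom x y zero    zero    = refl
sum-countedWeight≡eulerFrom x y zero    (suc b) = refl
sum-countedWeight≡eulerFrom x y (suc a) zero    = begin
  sum (map (countedWeight x y 0) (words (suc a)))                  ≡⟨ sum-map-words-suc _ a ⟩
  sum (map (λ _ → 0) W) + sum (map (countedWeight x y 0 ∘ (true ∷_)) W)
    ≡⟨ cong₂ _+_ (sum-map-const0 W) (sum-map-factor y _ _ (λ w → if-*ˡ y (zeros w ≡ᵇ 0) _) W) ⟩
  y * sum (map (countedWeight (suc x) y 0) W)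
    ≡⟨ cong (y *_) (sum-countedWeight≡eulerFrom (suc x) y a 0) ⟩
  y * eulerFrom (suc x) y a 0                                      ∎
  where
  open ≡-Reasoning
  W : List (List Bool)
  W = words a
sum-countedWeight≡eulerFrom x y (suc a) (suc b) = begin
  sum (map (countedWeight x y (suc b)) (words (suc a)))            ≡⟨ sum-map-words-suc _ a ⟩
  sum (map (countedWeight x y (suc b) ∘ (false ∷_)) W) + sum (map (countedWeight x y (suc b) ∘ (true ∷_)) W)
    ≡⟨ cong₂ _+_ (sum-map-factor x _ _ (λ w → if-*ˡ x (zeros w ≡ᵇ b) _) W)
                 (sum-map-factor y _ _ (λ w → if-*ˡ y (zeros w ≡ᵇ suc b) _) W) ⟩
  x * sum (map (countedWeight x (suc y) b) W) + y * sum (map (countedWeight (suc x) y (suc b)) W)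
    ≡⟨ cong₂ (λ u v → x * u + y * v) (sum-countedWeight≡eulerFrom x (suc y) a b)
                                     (sum-countedWeight≡eulerFrom (suc x) y a (suc b)) ⟩
  x * eulerFrom x (suc y) a b + y * eulerFrom (suc x) y a (suc b) ∎
  where
  open ≡-Reasoning
  W : List (List Bool)
  W = words a

assocEuler≡eulerFrom : ∀ ν μ a b → assocEuler ν μ a b ≡ eulerFrom (ν ∸ μ) (suc μ) a b
assocEuler≡eulerFrom ν μ a b = begin
  sum (map (weight ν μ) (filter (λ w → zeros w ≟ b) (words a)))
    ≡⟨ cong sum (map-cong (weight≡wordWeight ν μ) (filter (λ w → zeros w ≟ b) (words a))) ⟩
  sum (map (wordWeight (ν ∸ μ) (suc μ)) (filter (λ w → zeros w ≟ b) (words a)))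
    ≡⟨ sum-map-filter (λ w → zeros w ≟ b) _ (words a) ⟩
  sum (map (countedWeight (ν ∸ μ) (suc μ) b) (words a))
    ≡⟨ sum-countedWeight≡eulerFrom (ν ∸ μ) (suc μ) a b ⟩
  eulerFrom (ν ∸ μ) (suc μ) a b ∎
  where open ≡-Reasoning

n<k⇒euler≡0 : ∀ {n k} → n < k → euler n k ≡ 0
n<k⇒euler≡0 {zero}  {suc k} _ = refl
n<k⇒euler≡0 {suc n} {suc k} (s≤s n<k)
  rewrite m≤n⇒m∸n≡0 (<⇒≤ n<k) | n<k⇒euler≡0 (m<n⇒m<1+n n<k) = *-zeroʳ (suc (suc k))

record EulerRecurrence (c d : ℕ) (F : ℕ → ℕ → ℕ) : Set where
  field
    step-zero : ∀ a → F (suc a) 0 ≡ d * F a 0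
    step-suc  : ∀ a b → F (suc a) (suc b) ≡ (c + a ∸ b) * F a b + (d + suc b) * F a (suc b)

open EulerRecurrence

eulerFrom-recurrence : ∀ x y → EulerRecurrence x y (eulerFrom x y)
eulerFrom-recurrence x y .step-zero a = cong (y *_) (eulerFrom-noZeros (suc x) x y a)
eulerFrom-recurrence x y .step-suc    = eulerFrom-lastLetter x y

euler-recurrence : ∀ ν → EulerRecurrence ν 1 (λ a → euler (ν + a))
euler-recurrence ν .step-zero a   = cong (λ n → euler n 0) (+-suc ν a)
euler-recurrence ν .step-suc  a b = cong (λ n → euler n (suc b)) (+-suc ν a)

recurrence-unique : ∀ {c d F G} → EulerRecurrence c d F → EulerRecurrence c d G →
                    (∀ b → F 0 b ≡ G 0 b) → ∀ a b → F a b ≡ G a b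
recurrence-unique RF RG F₀≡G₀ zero b = F₀≡G₀ b
recurrence-unique {c} {d} {F} {G} RF RG F₀≡G₀ (suc a) b = step b
  where
  open ≡-Reasoning
  IH : ∀ b → F a b ≡ G a b
  IH = recurrence-unique RF RG F₀≡G₀ a
  step : ∀ b → F (suc a) b ≡ G (suc a) b
  step zero = begin
    F (suc a) 0 ≡⟨ RF .step-zero a ⟩
    d * F a 0   ≡⟨ cong (d *_) (IH 0) ⟩
    d * G a 0   ≡⟨ sym (RG .step-zero a) ⟩
    G (suc a) 0 ∎
  step (suc b) = begin
    F (suc a) (suc b)                                   ≡⟨ RF .step-suc a b ⟩
    (c + a ∸ b) * F a b + (d + suc b) * F a (suc b)
      ≡⟨ cong₂ (λ u v → (c + a ∸ b) * u + (d + suc b) * v) (IH b) (IH (suc b)) ⟩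
    (c + a ∸ b) * G a b + (d + suc b) * G a (suc b)     ≡⟨ sym (RG .step-suc a b) ⟩
    G (suc a) (suc b)                                   ∎

recurrence-zero : ∀ {c d} → EulerRecurrence c d (λ _ _ → 0)
recurrence-zero {c} {d} .step-zero a   = sym (*-zeroʳ d)
recurrence-zero {c} {d} .step-suc  a b = sym (cong₂ _+_ (*-zeroʳ (c + a ∸ b)) (*-zeroʳ (d + suc b)))

recurrence-+ : ∀ {c d F G} → EulerRecurrence c d F → EulerRecurrence c d G →
               EulerRecurrence c d (λ a b → F a b + G a b)
recurrence-+ {d = d} RF RG .step-zero a =
  trans (cong₂ _+_ (RF .step-zero a) (RG .step-zero a)) (sym (*-distribˡ-+ d _ _))
recurrence-+ {c} {d} RF RG .step-suc a b =
  trans (cong₂ _+_ (RF .step-suc a b) (RG .step-suc a b)) (ring (c + a ∸ b) (d + suc b) _ _ _ _)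
  where
  ring : ∀ α β f₁ f₂ g₁ g₂ → (α * f₁ + β * f₂) + (α * g₁ + β * g₂) ≡ α * (f₁ + g₁) + β * (f₂ + g₂)
  ring = solve-∀

recurrence-*ˡ : ∀ {c d F} r → EulerRecurrence c d F → EulerRecurrence c d (λ a b → r * F a b)
recurrence-*ˡ {d = d} r RF .step-zero a =
  trans (cong (r *_) (RF .step-zero a)) (ring r d _)
  where
  ring : ∀ r d f → r * (d * f) ≡ d * (r * f)
  ring = solve-∀
recurrence-*ˡ {c} {d} r RF .step-suc a b =
  trans (cong (r *_) (RF .step-suc a b)) (ring r (c + a ∸ b) (d + suc b) _ _)
  where
  ring : ∀ r α β f₁ f₂ → r * (α * f₁ + β * f₂) ≡ α * (r * f₁) + β * (r * f₂)
  ring = solve-∀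

recurrence-sumBelow : ∀ {c d} n (F : ℕ → ℕ → ℕ → ℕ) → (∀ k → k < n → EulerRecurrence c d (F k)) →
                      EulerRecurrence c d (λ a b → sumBelow n (λ k → F k a b))
recurrence-sumBelow zero    F RF = recurrence-zero
recurrence-sumBelow (suc n) F RF =
  recurrence-+ (RF 0 (s≤s z≤n)) (recurrence-sumBelow n (F ∘ suc) (λ k k<n → RF (suc k) (s≤s k<n)))

recurrence-shift : ∀ {c d F} → EulerRecurrence c (suc d) F → EulerRecurrence (suc c) d (shift F)
recurrence-shift {d = d} RF .step-zero a = sym (*-zeroʳ d)
recurrence-shift {c} {d} {F} RF .step-suc a zero =
  trans (RF .step-zero a) (cong₂ _+_ (sym (*-zeroʳ (suc c + a))) (cong (_* F a 0) (+-comm 1 d)))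
recurrence-shift {c} {d} {F} RF .step-suc a (suc b) =
  trans (RF .step-suc a b) (cong (λ n → (c + a ∸ b) * F a b + n * F a (suc b)) (sym (+-suc d (suc b))))

recurrence-shiftBy : ∀ {c d F} k → EulerRecurrence c (d + k) F → EulerRecurrence (k + c) d (shiftBy k F)
recurrence-shiftBy {c} {d} {F} zero    RF = subst (λ e → EulerRecurrence c e F) (+-identityʳ d) RF
recurrence-shiftBy {c} {d} {F} (suc k) RF =
  recurrence-shift (recurrence-shiftBy k (subst (λ e → EulerRecurrence c e F) (+-suc d k) RF))

euler≡eulerFrom : ∀ n m → euler n m ≡ eulerFrom 0 1 n m
euler≡eulerFrom = recurrence-unique (euler-recurrence 0) (eulerFrom-recurrence 0 1) row₀
  where
  row₀ : ∀ m → euler 0 m ≡ eulerFrom 0 1 0 m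
  row₀ zero    = refl
  row₀ (suc m) = refl

euler-+-expansion : ∀ ν a m →
  euler (ν + a) m ≡ sumBelow (suc ν) (λ k → euler ν k * shiftBy k (eulerFrom (ν ∸ k) (suc k)) a m)
euler-+-expansion ν = recurrence-unique (euler-recurrence ν) expansion-recurrence row₀
  where
  summand-recurrence : ∀ k → k ≤ ν → EulerRecurrence ν 1 (shiftBy k (eulerFrom (ν ∸ k) (suc k)))
  summand-recurrence k k≤ν =
    subst (λ c → EulerRecurrence c 1 (shiftBy k (eulerFrom (ν ∸ k) (suc k)))) (m+[n∸m]≡n k≤ν)
          (recurrence-shiftBy k (eulerFrom-recurrence (ν ∸ k) (suc k)))
  expansion-recurrence : EulerRecurrence ν 1
    (λ a m → sumBelow (suc ν) (λ k → euler ν k * shiftBy k (eulerFrom (ν ∸ k) (suc k)) a m))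
  expansion-recurrence = recurrence-sumBelow (suc ν) _
    (λ k k<1+ν → recurrence-*ˡ (euler ν k) (summand-recurrence k (≤-pred k<1+ν)))
  row₀ : ∀ m → euler (ν + 0) m ≡
               sumBelow (suc ν) (λ k → euler ν k * shiftBy k (eulerFrom (ν ∸ k) (suc k)) 0 m)
  row₀ m = trans (cong (λ n → euler n m) (+-identityʳ ν))
    (sym (sumBelow-sift (suc ν) (euler ν) (λ k → eulerFrom (ν ∸ k) (suc k)) m
                        (λ _ → refl) (λ _ _ → refl) n<k⇒euler≡0))

euler-firstZeroExpansion : (n m : ℕ) → 1 ≤ m → m ≤ n →
  euler n m ≡ sumFromTo 1 (n ∸ m) (λ j → j * assocEuler (j + 1) 1 (n ∸ j ∸ 1) (m ∸ 1))
euler-firstZeroExpansion n (suc p) _ m≤n with m≤n⇒∃[o]m+o≡n m≤n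
... | q , refl = begin
  euler (suc p + q) (suc p)          ≡⟨ euler≡eulerFrom (suc p + q) (suc p) ⟩
  -- the summand i = 0 is 0 * ⋯
  eulerFrom 0 1 (suc p + q) (suc p)  ≡⟨ eulerFrom-firstZero 0 p q ⟩
  sumBelow q (λ i → suc i * eulerFrom (suc i) 2 (p + (q ∸ suc i)) p)
    ≡⟨ sumBelow-cong q (λ i i<q → cong (suc i *_) (sym (summand i i<q))) ⟩
  sumBelow q (λ i → suc i * assocEuler (suc i + 1) 1 (suc p + q ∸ suc i ∸ 1) p)
    ≡⟨ sym (sumFromTo≡sumBelow 1 q term) ⟩
  sumFromTo 1 q term
    ≡⟨ cong (λ h → sumFromTo 1 h term) (sym (m+n∸m≡n (suc p) q)) ⟩
  sumFromTo 1 (suc p + q ∸ suc p) term ∎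
  where
  open ≡-Reasoning
  term : ℕ → ℕ
  term j = j * assocEuler (j + 1) 1 (suc p + q ∸ j ∸ 1) p
  summand : ∀ i → i < q →
            assocEuler (suc i + 1) 1 (suc p + q ∸ suc i ∸ 1) p ≡ eulerFrom (suc i) 2 (p + (q ∸ suc i)) p
  summand i i<q = begin
    assocEuler (suc i + 1) 1 (p + q ∸ i ∸ 1) p       ≡⟨ assocEuler≡eulerFrom (suc i + 1) 1 (p + q ∸ i ∸ 1) p ⟩
    eulerFrom (suc i + 1 ∸ 1) 2 (p + q ∸ i ∸ 1) p
      ≡⟨ cong₂ (λ x a → eulerFrom x 2 a p) (m+n∸n≡m (suc i) 1) (begin
      p + q ∸ i ∸ 1   ≡⟨ ∸-+-assoc (p + q) i 1 ⟩
      p + q ∸ (i + 1) ≡⟨ cong (p + q ∸_) (+-comm i 1) ⟩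
      p + q ∸ suc i   ≡⟨ +-∸-assoc p i<q ⟩
      p + (q ∸ suc i) ∎) ⟩
    eulerFrom (suc i) 2 (p + (q ∸ suc i)) p           ∎

euler-prefixExpansion : (n m ν : ℕ) → m ≤ n → 1 ≤ ν → ν ≤ n ∸ 1 →
  euler n m ≡ sumFromTo 0 ν (λ k → euler ν k * assocEulerSub ν k (n ∸ ν) m k)
euler-prefixExpansion n m ν _ _ ν≤n∸1 with m≤n⇒∃[o]m+o≡n (≤-trans ν≤n∸1 (m∸n≤m n 1))
... | a , refl = begin
  euler (ν + a) m
    ≡⟨ euler-+-expansion ν a m ⟩
  sumBelow (suc ν) (λ k → euler ν k * shiftBy k (eulerFrom (ν ∸ k) (suc k)) a m)
    ≡⟨ sumBelow-cong (suc ν) (λ k _ → cong (euler ν k *_) (summand k)) ⟩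
  sumBelow (suc ν) (λ k → euler ν k * assocEulerSub ν k (ν + a ∸ ν) m k)
    ≡⟨ sym (sumFromTo≡sumBelow 0 ν _) ⟩
  sumFromTo 0 ν (λ k → euler ν k * assocEulerSub ν k (ν + a ∸ ν) m k) ∎
  where
  open ≡-Reasoning
  summand : ∀ k → shiftBy k (eulerFrom (ν ∸ k) (suc k)) a m ≡ assocEulerSub ν k (ν + a ∸ ν) m k
  summand k = trans (shiftBy≡if k _ a m) (cong (λ z → if k ≤ᵇ m then z else 0) (sym (begin
    assocEuler ν k (ν + a ∸ ν) (m ∸ k) ≡⟨ cong (λ a′ → assocEuler ν k a′ (m ∸ k)) (m+n∸m≡n ν a) ⟩
    assocEuler ν k a (m ∸ k)           ≡⟨ assocEuler≡eulerFrom ν k a (m ∸ k) ⟩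
    eulerFrom (ν ∸ k) (suc k) a (m ∸ k) ∎)))

theorem6p4 :
    ((n m : ℕ) → 1 ≤ m → m ≤ n →
      euler n m ≡ sumFromTo 1 (n ∸ m) (λ j → j * assocEuler (j + 1) 1 (n ∸ j ∸ 1) (m ∸ 1)))
    × ((n m ν : ℕ) → m ≤ n → 1 ≤ ν → ν ≤ n ∸ 1 →
      euler n m ≡ sumFromTo 0 ν (λ k → euler ν k * assocEulerSub ν k (n ∸ ν) m k))
theorem6p4 = euler-firstZeroExpansion , euler-prefixExpansion
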